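{- Let $G=(V,E)$ be a finite, undirected, unweighted, 2-vertex-connected graph with $n=|V|$ vertices. If $G$ contains a Hamiltonian path, then $G$ has a TSP tour of length at most $4n/3$.
   Context: A Hamiltonian path is a path visiting each vertex of $V$ exactly once. A TSP tour of $G$ is a closed walk in $G$ that visits every vertex at least once; its length is the number of edges traversed, counted with multiplicity (equivalently, the tour length in the shortest-path metric of $G$). -}

module Defs where

open import Data.Nat using (ℕ; zero; suc; _+_; _*_; _≤_)
open import Data.Fin using (Fin)
open import Data.List using (List; []; _∷_; length)
open import Data.List.Membership.Propositional using (_∈_)
open import Data.List.Relation.Unary.All using (All)
open import Data.List.Relation.Unary.Unique.Propositional using (Unique)
open import Data.Product using (Σ; _×_; _,_; ∃; ∃-syntax)
open import Relation.Binary.PropositionalEquality using (_≡_; _≢_)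
open import Relation.Nullary using (¬_)


record Graph (n : ℕ) : Set₁ where
  field
    Adj   : Fin n → Fin n → Set
    sym   : ∀ {u v} → Adj u v → Adj v u
    irrefl : ∀ {u} → ¬ Adj u u

open Graph public

data Walk {n : ℕ} (G : Graph n) : Fin n → Fin n → Set where
  [_]  : (v : Fin n) → Walk G v v
  _∷⟨_⟩_ : (u : Fin n) → {v w : Fin n} → Adj G u v → Walk G v w → Walk G u w

infixr 5 _∷⟨_⟩_

vertices : ∀ {n} {G : Graph n} {u v} → Walk G u v → List (Fin n)
vertices [ v ] = v ∷ []
vertices (u ∷⟨ _ ⟩ p) = u ∷ vertices p

len : ∀ {n} {G : Graph n} {u v} → Walk G u v → ℕ
len [ v ] = zero
len (u ∷⟨ _ ⟩ p) = suc (len p)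

Connected : ∀ {n} → Graph n → Set
Connected {n} G = (u v : Fin n) → Walk G u v

ConnectedWithout : ∀ {n} → Graph n → Fin n → Set
ConnectedWithout {n} G w =
  (u v : Fin n) → u ≢ w → v ≢ w →
  Σ (Walk G u v) λ p → All (λ x → x ≢ w) (vertices p)

TwoVertexConnected : ∀ {n} → Graph n → Set
TwoVertexConnected {n} G =
  (3 ≤ n) × Connected G × ((w : Fin n) → ConnectedWithout G w)

HamiltonianPath : ∀ {n} → Graph n → Set
HamiltonianPath {n} G =
  Σ (Fin n) λ u → Σ (Fin n) λ v → Σ (Walk G u v) λ p →
    Unique (vertices p) × ((x : Fin n) → x ∈ vertices p)

TSPTour : ∀ {n} → Graph n → Set
TSPTour {n} G =
  Σ (Fin n) λ s → Σ (Walk G s s) λ p → ((x : Fin n) → x ∈ vertices p)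

tourLength : ∀ {n} {G : Graph n} → TSPTour G → ℕ
tourLength (s , p , _) = len p

-- Number the Hamiltonian path v₀ … v_N (so n = N + 1). No interior v_i is a cut vertex, so a
-- walk from v₀ to v_N avoiding v_i crosses position i along an edge: every 0 < i < N is spanned
-- by a chord v_a v_b with a < i < b. Along the path we maintain stages s < e consisting of a
-- closed walk T through v₀ … v_e, the closed walk T′ through v₀ … v_s of the previous stage and a
-- bridge B from v_s to v_e through v₀ … v_s, with
--   2|B| + |T′| ≤ 4s + 2,   |T| + s ≤ e + |B|,   3|T| ≤ 4e + 2.
-- A chord (a, b) spanning e with s ≤ a yields a bridge B″ from v_e to v_b, routed either back
-- through B or through T′; the first two bounds guarantee that one of the two routes satisfies
-- 2|B″| + |T| ≤ 4e + 2. The next tour is the shorter of "down the path to v_e, then B″" and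
-- "down the path, T, and back up"; twice the first plus the second is at most 4b + 2, so the
-- shorter one has 3|T| ≤ 4b + 2. At e = N this gives 3|T| ≤ 4N + 2 ≤ 4n.

module Submission where

open import Defs
open import Data.Fin using (Fin; toℕ; fromℕ<)
open import Data.Fin.Properties using (injective⇒≤; toℕ-injective; toℕ<n; fromℕ<-injective)
open import Data.List using ([]; _∷_)
open import Data.List.Membership.Propositional using (_∈_)
open import Data.List.Relation.Binary.Subset.Propositional using (_⊆_)
import Data.List.Relation.Unary.All as All
open All using (All)
import Data.List.Relation.Unary.AllPairs as AllPairs
open import Data.List.Relation.Unary.Any using (here; there)
open import Data.List.Relation.Unary.Unique.Propositional using (Unique)
open import Data.Nat
open import Data.Nat.Properties
open import Data.Nat.Tactic.RingSolver using (solve)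
open import Data.Product using (Σ; ∃-syntax; _×_; _,_; proj₁; proj₂)
open import Data.Sum using (_⊎_; inj₁; inj₂; [_,_]′)
open import Function using (_∘_)
open import Relation.Binary.Definitions using (tri<; tri≈; tri>)
import Relation.Binary.PropositionalEquality as ≡
open ≡ using (_≡_; _≢_; refl; cong; cong₂; subst; subst₂)
open import Relation.Nullary using (yes; no; contradiction)

3*m⊓n≤2*m+n : ∀ m n → 3 * (m ⊓ n) ≤ 2 * m + n
3*m⊓n≤2*m+n m n = begin
  3 * (m ⊓ n)         ≡⟨ +-comm (m ⊓ n) (2 * (m ⊓ n)) ⟩
  2 * (m ⊓ n) + m ⊓ n ≤⟨ +-mono-≤ (*-monoʳ-≤ 2 (m⊓n≤m m n)) (m⊓n≤n m n) ⟩
  2 * m + n           ∎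
  where open ≤-Reasoning

extended-tour-bound : ∀ t e r D → 2 * r + D ≤ 4 * e + 2 → 2 * (t + r) + (t + (D + t)) ≤ 4 * (t + e) + 2
extended-tour-bound t e r D h = begin
  2 * (t + r) + (t + (D + t)) ≡⟨ solve (t ∷ r ∷ D ∷ []) ⟩
  4 * t + (2 * r + D)         ≤⟨ +-monoʳ-≤ (4 * t) h ⟩
  4 * t + (4 * e + 2)         ≡⟨ solve (t ∷ e ∷ []) ⟩
  4 * (t + e) + 2             ∎
  where open ≤-Reasoning

-- In the three lemmas below a chord from v_a, s ≤ a = u + s < e = q + 1 + a, extends a stage
-- whose bridge, previous tour and tour have lengths r, E and D.
bridge-dichotomy : ∀ s u q r E D → 2 * r + E ≤ 4 * s + 2 → D + s ≤ q + suc (u + s) + r →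
                   2 * r + D ≤ 2 * u + 4 * s + 4 ⊎ 2 * E + D ≤ 2 * q + 4 * s + 2
bridge-dichotomy s u q r E D bridge-bound tour-vs-bridge with 2 * r + D ≤? 2 * u + 4 * s + 4
... | yes small = inj₁ small
... | no  large =
  inj₂ (≤-trans (+-cancelʳ-≤ (2 * u + 6 * s + 5 + 4 * r + D) (2 * E + D) (2 * q + 4 * s + 1) combined)
                (+-monoʳ-≤ (2 * q + 4 * s) (n≤1+n 1)))
  where
  open ≤-Reasoning
  combined : 2 * E + D + (2 * u + 6 * s + 5 + 4 * r + D) ≤
             2 * q + 4 * s + 1 + (2 * u + 6 * s + 5 + 4 * r + D)
  combined = begin
    2 * E + D + (2 * u + 6 * s + 5 + 4 * r + D)
      ≡⟨ solve (s ∷ u ∷ r ∷ E ∷ D ∷ []) ⟩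
    suc (2 * u + 4 * s + 4) + 2 * (2 * r + E) + 2 * (D + s)
      ≤⟨ +-mono-≤ (+-mono-≤ (≰⇒> large) (*-monoʳ-≤ 2 bridge-bound)) (*-monoʳ-≤ 2 tour-vs-bridge) ⟩
    2 * r + D + 2 * (4 * s + 2) + 2 * (q + suc (u + s) + r)
      ≡⟨ solve (s ∷ u ∷ q ∷ r ∷ D ∷ []) ⟩
    2 * q + 4 * s + 1 + (2 * u + 6 * s + 5 + 4 * r + D) ∎

via-bridge-bound : ∀ s u q r D → 2 * r + D ≤ 2 * u + 4 * s + 4 →
                   2 * (q + (q + (r + (u + 1)))) + D ≤ 4 * (q + suc (u + s)) + 2
via-bridge-bound s u q r D small = begin
  2 * (q + (q + (r + (u + 1)))) + D         ≡⟨ solve (u ∷ q ∷ r ∷ D ∷ []) ⟩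
  (2 * r + D) + (4 * q + 2 * u + 2)         ≤⟨ +-monoˡ-≤ (4 * q + 2 * u + 2) small ⟩
  (2 * u + 4 * s + 4) + (4 * q + 2 * u + 2) ≡⟨ solve (s ∷ u ∷ q ∷ []) ⟩
  4 * (q + suc (u + s)) + 2                 ∎
  where open ≤-Reasoning

via-tour-bound : ∀ s u q E D → 2 * E + D ≤ 2 * q + 4 * s + 2 →
                 2 * (q + (suc u + (E + (u + 1)))) + D ≤ 4 * (q + suc (u + s)) + 2
via-tour-bound s u q E D small = begin
  2 * (q + (suc u + (E + (u + 1)))) + D     ≡⟨ solve (u ∷ q ∷ E ∷ D ∷ []) ⟩
  (2 * E + D) + (2 * q + 4 * u + 4)         ≤⟨ +-monoˡ-≤ (2 * q + 4 * u + 4) small ⟩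
  (2 * q + 4 * s + 2) + (2 * q + 4 * u + 4) ≡⟨ solve (s ∷ u ∷ q ∷ []) ⟩
  4 * (q + suc (u + s)) + 2                 ∎
  where open ≤-Reasoning

module _ {n : ℕ} {G : Graph n} where

  infixr 5 _++ʷ_

  _++ʷ_ : ∀ {a b c} → Walk G a b → Walk G b c → Walk G a c
  [ _ ] ++ʷ q = q
  (u ∷⟨ e ⟩ p) ++ʷ q = u ∷⟨ e ⟩ (p ++ʷ q)

  edge : ∀ {a b} → Adj G a b → Walk G a b
  edge {a} {b} e = a ∷⟨ e ⟩ [ b ]

  reverse : ∀ {a b} → Walk G a b → Walk G b a
  reverse [ u ] = [ u ]
  reverse (u ∷⟨ e ⟩ p) = reverse p ++ʷ edge (sym G e)

  len-++ʷ : ∀ {a b c} (p : Walk G a b) (q : Walk G b c) → len (p ++ʷ q) ≡ len p + len q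
  len-++ʷ [ _ ] q = refl
  len-++ʷ (u ∷⟨ e ⟩ p) q = cong suc (len-++ʷ p q)

  infixr 5 _⟨++ʷ⟩_

  _⟨++ʷ⟩_ : ∀ {a b c l m} {p : Walk G a b} {q : Walk G b c} →
            len p ≡ l → len q ≡ m → len (p ++ʷ q) ≡ l + m
  _⟨++ʷ⟩_ {p = p} {q} refl refl = len-++ʷ p q

  len-reverse : ∀ {a b} (p : Walk G a b) → len (reverse p) ≡ len p
  len-reverse [ _ ] = refl
  len-reverse (u ∷⟨ e ⟩ p) =
    ≡.trans (len-++ʷ (reverse p) _) (≡.trans (+-comm _ 1) (cong suc (len-reverse p)))

  source∈ : ∀ {a b} (p : Walk G a b) → a ∈ vertices p
  source∈ [ _ ] = here refl
  source∈ (_ ∷⟨ _ ⟩ _) = here refl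

  ∈-++ʷ⁺ˡ : ∀ {a b c} (p : Walk G a b) (q : Walk G b c) → vertices p ⊆ vertices (p ++ʷ q)
  ∈-++ʷ⁺ˡ [ _ ] q (here refl) = source∈ q
  ∈-++ʷ⁺ˡ (_ ∷⟨ _ ⟩ p) q (here eq) = here eq
  ∈-++ʷ⁺ˡ (_ ∷⟨ _ ⟩ p) q (there z∈p) = there (∈-++ʷ⁺ˡ p q z∈p)

  ∈-++ʷ⁺ʳ : ∀ {a b c} (p : Walk G a b) (q : Walk G b c) → vertices q ⊆ vertices (p ++ʷ q)
  ∈-++ʷ⁺ʳ [ _ ] q z∈q = z∈q
  ∈-++ʷ⁺ʳ (_ ∷⟨ _ ⟩ p) q z∈q = there (∈-++ʷ⁺ʳ p q z∈q)

  ∈-reverse⁺ : ∀ {a b} (p : Walk G a b) → vertices p ⊆ vertices (reverse p)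
  ∈-reverse⁺ [ _ ] z∈p = z∈p
  ∈-reverse⁺ (u ∷⟨ e ⟩ p) (here refl) = ∈-++ʷ⁺ʳ (reverse p) (edge (sym G e)) (there (here refl))
  ∈-reverse⁺ (u ∷⟨ e ⟩ p) (there z∈p) = ∈-++ʷ⁺ˡ (reverse p) _ (∈-reverse⁺ p z∈p)

  shorter : ∀ {a b} → Walk G a b → Walk G a b → Walk G a b
  shorter p q with len p ≤? len q
  ... | yes _ = p
  ... | no _  = q

  len-shorter : ∀ {a b} (p q : Walk G a b) → len (shorter p q) ≡ len p ⊓ len q
  len-shorter p q with len p ≤? len q
  ... | yes p≤q = ≡.sym (m≤n⇒m⊓n≡m p≤q)
  ... | no  p≰q = ≡.sym (m≥n⇒m⊓n≡n (<⇒≤ (≰⇒> p≰q)))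

  shorter-elim : ∀ {ℓ a b} (P : Walk G a b → Set ℓ) {p q : Walk G a b} → P p → P q → P (shorter p q)
  shorter-elim P {p} {q} Pp Pq with len p ≤? len q
  ... | yes _ = Pp
  ... | no _  = Pq

  -- Positions past the end of the walk give its last vertex.
  vertexAt : ∀ {a b} → Walk G a b → ℕ → Fin n
  vertexAt [ u ] _ = u
  vertexAt (u ∷⟨ _ ⟩ p) zero = u
  vertexAt (u ∷⟨ _ ⟩ p) (suc k) = vertexAt p k

  vertexAt-zero : ∀ {a b} (p : Walk G a b) → vertexAt p 0 ≡ a
  vertexAt-zero [ _ ] = refl
  vertexAt-zero (_ ∷⟨ _ ⟩ _) = refl

  vertexAt-adj : ∀ {a b} (p : Walk G a b) k → k < len p → Adj G (vertexAt p k) (vertexAt p (suc k))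
  vertexAt-adj (u ∷⟨ e ⟩ p) zero _ = subst (Adj G u) (≡.sym (vertexAt-zero p)) e
  vertexAt-adj (u ∷⟨ e ⟩ p) (suc k) k<len = vertexAt-adj p k (s≤s⁻¹ k<len)

  vertexAt-∈ : ∀ {a b} (p : Walk G a b) k → vertexAt p k ∈ vertices p
  vertexAt-∈ [ _ ] k = here refl
  vertexAt-∈ (_ ∷⟨ _ ⟩ p) zero = here refl
  vertexAt-∈ (_ ∷⟨ _ ⟩ p) (suc k) = there (vertexAt-∈ p k)

  ∈⇒vertexAt : ∀ {a b z} (p : Walk G a b) → z ∈ vertices p → ∃[ k ] k ≤ len p × vertexAt p k ≡ z
  ∈⇒vertexAt [ _ ] (here refl) = 0 , z≤n , refl
  ∈⇒vertexAt (_ ∷⟨ _ ⟩ p) (here refl) = 0 , z≤n , refl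
  ∈⇒vertexAt (_ ∷⟨ _ ⟩ p) (there z∈p) with ∈⇒vertexAt p z∈p
  ... | k , k≤len , eq = suc k , s≤s k≤len , eq

  vertexAt-injective : ∀ {a b} (p : Walk G a b) → Unique (vertices p) → ∀ {i j} →
                       i ≤ len p → j ≤ len p → vertexAt p i ≡ vertexAt p j → i ≡ j
  vertexAt-injective [ _ ] _ {zero} {zero} _ _ _ = refl
  vertexAt-injective (_ ∷⟨ _ ⟩ p) _ {zero} {zero} _ _ _ = refl
  vertexAt-injective (_ ∷⟨ _ ⟩ p) unique {zero} {suc j} _ _ eq =
    contradiction eq (All.lookup (AllPairs.head unique) (vertexAt-∈ p j))
  vertexAt-injective (_ ∷⟨ _ ⟩ p) unique {suc i} {zero} _ _ eq =
    contradiction (≡.sym eq) (All.lookup (AllPairs.head unique) (vertexAt-∈ p i))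
  vertexAt-injective (_ ∷⟨ _ ⟩ p) unique {suc i} {suc j} i≤len j≤len eq =
    cong suc (vertexAt-injective p (AllPairs.tail unique) (s≤s⁻¹ i≤len) (s≤s⁻¹ j≤len) eq)

module Positions {n : ℕ} {G : Graph n} {x y : Fin n} (P : Walk G x y) where

  N : ℕ
  N = len P

  v : ℕ → Fin n
  v = vertexAt P

  segment : ∀ i d → d + i ≤ N → Walk G (v i) (v (d + i))
  segment i zero    _ = [ v i ]
  segment i (suc d) h = segment i d (<⇒≤ h) ++ʷ edge (vertexAt-adj P (d + i) h)

  len-segment : ∀ i d h → len (segment i d h) ≡ d
  len-segment i zero    _ = refl
  len-segment i (suc d) h =
    ≡.trans (len-++ʷ (segment i d _) _) (≡.trans (cong (_+ 1) (len-segment i d _)) (+-comm d 1))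

  segment-covers : ∀ i d h {m} → i ≤ m → m ≤ d + i → v m ∈ vertices (segment i d h)
  segment-covers i zero _ i≤m m≤i with ≤-antisym m≤i i≤m
  ... | refl = here refl
  segment-covers i (suc d) h i≤m m≤ with m≤n⇒m<n∨m≡n m≤
  ... | inj₁ m< = ∈-++ʷ⁺ˡ (segment i d _) _ (segment-covers i d _ i≤m (m<1+n⇒m≤n m<))
  ... | inj₂ refl = ∈-++ʷ⁺ʳ (segment i d _) (edge _) (there (here refl))

  Covers : ∀ {a b} → Walk G a b → ℕ → Set
  Covers w k = ∀ {m} → m ≤ k → v m ∈ vertices w

  covers-join : ∀ {a b i k} {w : Walk G a b} → Covers w i →
                (∀ {m} → i < m → m ≤ k → v m ∈ vertices w) → Covers w k
  covers-join {i = i} covers-i covers-rest {m} m≤k with m ≤? i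
  ... | yes m≤i = covers-i m≤i
  ... | no  m≰i = covers-rest (≰⇒> m≰i) m≤k

  record Stage (s e : ℕ) : Set where
    field
      s<e : s < e
      e≤N : e ≤ N
      previousTour : Walk G (v s) (v s)
      bridge       : Walk G (v s) (v e)
      tour         : Walk G (v e) (v e)
      previousTour-covers : Covers previousTour s
      bridge-covers       : Covers bridge s
      tour-covers         : Covers tour e
      bridge-bound    : 2 * len bridge + len previousTour ≤ 4 * s + 2
      tour-vs-bridge  : len tour + s ≤ e + len bridge
      tour-bound      : 3 * len tour ≤ 4 * e + 2

  open Stage

  initialStage : 0 < N → Stage 0 1
  initialStage 0<N = record
    { s<e = z<s ; e≤N = 0<N
    ; previousTour = [ v 0 ] ; bridge = first ; tour = reverse first ++ʷ first
    ; previousTour-covers = λ { z≤n → here refl }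
    ; bridge-covers = λ { z≤n → here refl }
    ; tour-covers = λ { z≤n → there (here refl) ; (s≤s z≤n) → here refl }
    ; bridge-bound = ≤-refl ; tour-vs-bridge = ≤-refl ; tour-bound = ≤-refl }
    where
    first : Walk G (v 0) (v 1)
    first = edge (vertexAt-adj P 0 0<N)

  extendStage : ∀ {s e b} (st : Stage s e) → e < b → b ≤ N →
                (R : Walk G (v e) (v b)) → Covers R e → 2 * len R + len (tour st) ≤ 4 * e + 2 → Stage e b
  extendStage {e = e} {b} st e<b b≤N R R-covers R-bound with b ∸ e | m∸n+n≡m (<⇒≤ e<b)
  ... | t | refl = record
    { s<e = e<b ; e≤N = b≤N
    ; previousTour = tour st ; bridge = R ; tour = shorter viaR viaTour
    ; previousTour-covers = tour-covers st ; bridge-covers = R-covers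
    ; tour-covers = shorter-elim (λ w → Covers w (t + e)) (returning R R-covers)
                      (returning (tour st ++ʷ Sb) (∈-++ʷ⁺ˡ (tour st) Sb ∘ tour-covers st))
    ; bridge-bound = R-bound
    ; tour-vs-bridge = begin
        len (shorter viaR viaTour) + e ≤⟨ +-monoˡ-≤ e shorter≤viaR ⟩
        len viaR + e                   ≡⟨ cong (_+ e) len-viaR ⟩
        t + len R + e                  ≡⟨ +-assoc t (len R) e ⟩
        t + (len R + e)                ≡⟨ cong (t +_) (+-comm (len R) e) ⟩
        t + (e + len R)                ≡⟨ +-assoc t e (len R) ⟨
        t + e + len R                  ∎
    ; tour-bound = begin
        3 * len (shorter viaR viaTour)  ≡⟨ cong (3 *_) (len-shorter viaR viaTour) ⟩
        3 * (len viaR ⊓ len viaTour)    ≤⟨ 3*m⊓n≤2*m+n (len viaR) (len viaTour) ⟩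
        2 * len viaR + len viaTour      ≡⟨ cong₂ (λ X Y → 2 * X + Y) len-viaR len-viaTour ⟩
        2 * (t + len R) + (t + (D + t)) ≤⟨ extended-tour-bound t e (len R) D R-bound ⟩
        4 * (t + e) + 2                 ∎
    }
    where
    open ≤-Reasoning
    D : ℕ
    D = len (tour st)
    Sb : Walk G (v e) (v (t + e))
    Sb = segment e t b≤N
    viaR viaTour : Walk G (v (t + e)) (v (t + e))
    viaR = reverse Sb ++ʷ R
    viaTour = reverse Sb ++ʷ tour st ++ʷ Sb
    len-reverse-Sb : len (reverse Sb) ≡ t
    len-reverse-Sb = ≡.trans (len-reverse Sb) (len-segment e t b≤N)
    len-viaR : len viaR ≡ t + len R
    len-viaR = len-reverse-Sb ⟨++ʷ⟩ refl
    len-viaTour : len viaTour ≡ t + (D + t)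
    len-viaTour = len-reverse-Sb ⟨++ʷ⟩ refl ⟨++ʷ⟩ len-segment e t b≤N
    shorter≤viaR : len (shorter viaR viaTour) ≤ len viaR
    shorter≤viaR = ≤-trans (≤-reflexive (len-shorter viaR viaTour)) (m⊓n≤m (len viaR) (len viaTour))
    returning : (w : Walk G (v e) (v (t + e))) → Covers w e → Covers (reverse Sb ++ʷ w) (t + e)
    returning w w-covers = covers-join (∈-++ʷ⁺ʳ (reverse Sb) w ∘ w-covers)
      (λ e<m m≤b → ∈-++ʷ⁺ˡ (reverse Sb) w (∈-reverse⁺ Sb (segment-covers e t b≤N (<⇒≤ e<m) m≤b)))

  -- Writing a = u + s and e = q + 1 + a makes the indices of all path segments literal sums.
  advance : ∀ {s e a b} (st : Stage s e) → s ≤ a → a < e → e < b → b ≤ N → Adj G (v a) (v b) →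
            Stage e b
  advance {s} {e} {a} {b} st s≤a a<e e<b b≤N chord with a ∸ s | m∸n+n≡m s≤a
  ... | u | refl with e ∸ suc (u + s) | m∸n+n≡m a<e
  ... | q | refl =
    [ (λ small → extendStage st e<b b≤N viaBridge viaBridge-covers
                   (subst (λ l → 2 * l + D ≤ 4 * (q + suc (u + s)) + 2) (≡.sym len-viaBridge)
                          (via-bridge-bound s u q (len R) D small)))
    , (λ small → extendStage st e<b b≤N viaTour viaTour-covers
                   (subst (λ l → 2 * l + D ≤ 4 * (q + suc (u + s)) + 2) (≡.sym len-viaTour)
                          (via-tour-bound s u q (len Q) D small)))
    ]′ (bridge-dichotomy s u q (len R) (len Q) D (bridge-bound st) (tour-vs-bridge st))
    where
    Q : Walk G (v s) (v s)
    Q = previousTour st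
    R : Walk G (v s) (v (q + suc (u + s)))
    R = bridge st
    D : ℕ
    D = len (tour st)
    a≤N : u + s ≤ N
    a≤N = ≤-trans (<⇒≤ a<e) (e≤N st)
    Sa : Walk G (v s) (v (u + s))
    Sa = segment s u a≤N
    Sa⁺ : Walk G (v s) (v (suc (u + s)))
    Sa⁺ = segment s (suc u) (≤-trans a<e (e≤N st))
    Se : Walk G (v (suc (u + s))) (v (q + suc (u + s)))
    Se = segment (suc (u + s)) q (e≤N st)
    viaBridge viaTour : Walk G (v (q + suc (u + s))) (v b)
    viaBridge = reverse Se ++ʷ Se ++ʷ reverse R ++ʷ Sa ++ʷ edge chord
    viaTour = reverse Se ++ʷ reverse Sa⁺ ++ʷ Q ++ʷ Sa ++ʷ edge chord
    len-Sa : len Sa ≡ u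
    len-Sa = len-segment s u a≤N
    len-Se : len Se ≡ q
    len-Se = len-segment (suc (u + s)) q (e≤N st)
    len-reverse-Se : len (reverse Se) ≡ q
    len-reverse-Se = ≡.trans (len-reverse Se) len-Se
    len-viaBridge : len viaBridge ≡ q + (q + (len R + (u + 1)))
    len-viaBridge = len-reverse-Se ⟨++ʷ⟩ len-Se ⟨++ʷ⟩ len-reverse R ⟨++ʷ⟩ len-Sa ⟨++ʷ⟩ refl
    len-viaTour : len viaTour ≡ q + (suc u + (len Q + (u + 1)))
    len-viaTour = len-reverse-Se ⟨++ʷ⟩ ≡.trans (len-reverse Sa⁺) (len-segment s (suc u) _)
                  ⟨++ʷ⟩ ≡.refl {x = len Q} ⟨++ʷ⟩ len-Sa ⟨++ʷ⟩ refl
    through-Se : ∀ {c d} {w : Walk G c d} → Covers w (u + s) → vertices Se ⊆ vertices w →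
                 Covers w (q + suc (u + s))
    through-Se w-covers Se⊆w =
      covers-join w-covers (λ a<m m≤e → Se⊆w (segment-covers (suc (u + s)) q (e≤N st) a<m m≤e))
    viaBridge-covers : Covers viaBridge (q + suc (u + s))
    viaBridge-covers = through-Se
      (covers-join (∈-++ʷ⁺ʳ (reverse Se) _ ∘ ∈-++ʷ⁺ʳ Se _ ∘ ∈-++ʷ⁺ˡ (reverse R) _ ∘ ∈-reverse⁺ R
                      ∘ bridge-covers st)
                   (λ s<m m≤a → (∈-++ʷ⁺ʳ (reverse Se) _ ∘ ∈-++ʷ⁺ʳ Se _ ∘ ∈-++ʷ⁺ʳ (reverse R) _ ∘ ∈-++ʷ⁺ˡ Sa _)
                                  (segment-covers s u a≤N (<⇒≤ s<m) m≤a)))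
      (∈-++ʷ⁺ʳ (reverse Se) _ ∘ ∈-++ʷ⁺ˡ Se _)
    viaTour-covers : Covers viaTour (q + suc (u + s))
    viaTour-covers = through-Se
      (covers-join (∈-++ʷ⁺ʳ (reverse Se) _ ∘ ∈-++ʷ⁺ʳ (reverse Sa⁺) _ ∘ ∈-++ʷ⁺ˡ Q _
                      ∘ previousTour-covers st)
                   (λ s<m m≤a → (∈-++ʷ⁺ʳ (reverse Se) _ ∘ ∈-++ʷ⁺ˡ (reverse Sa⁺) _ ∘ ∈-reverse⁺ Sa⁺)
                                  (segment-covers s (suc u) _ (<⇒≤ s<m) (m≤n⇒m≤1+n m≤a))))
      (∈-++ʷ⁺ˡ (reverse Se) _ ∘ ∈-reverse⁺ Se)

  data Chain : ℕ → Set where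
    first : ∀ {e} → Stage 0 e → Chain e
    _▷_   : ∀ {s e} → Chain s → Stage s e → Chain e

  top : ∀ {e} → Chain e → ∃[ s ] Stage s e
  top (first st) = 0 , st
  top (_▷_ {s} _ st) = s , st

  -- A chord reaching below the start s of the current stage also spans s, so it extends
  -- the stage ending at s instead.
  extend : ∀ {e a b} → Chain e → a < e → e < b → b ≤ N → Adj G (v a) (v b) → Chain b
  extend c@(first st) a<e e<b b≤N chord = c ▷ advance st z≤n a<e e<b b≤N chord
  extend {a = a} c@(_▷_ {s} earlier st) a<e e<b b≤N chord with s ≤? a
  ... | yes s≤a = c ▷ advance st s≤a a<e e<b b≤N chord
  ... | no  s≰a = extend earlier (≰⇒> s≰a) (<-trans (s<e st) e<b) b≤N chord

  record SpanningChord (i : ℕ) : Set where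
    constructor spanning
    field
      {a b} : ℕ
      a<i   : a < i
      i<b   : i < b
      b≤N   : b ≤ N
      chord : Adj G (v a) (v b)

  module _ (spanned : ∀ {i} → 0 < i → i < N → SpanningChord i) where

    reach : ∀ fuel {e} → Chain e → N ≤ fuel + e → Chain N
    reach fuel {e} c N≤ with top c | e <? N
    ... | _ , st | no e≮N = subst Chain (≤-antisym (e≤N st) (≮⇒≥ e≮N)) c
    reach zero c N≤e | _ | yes e<N = contradiction N≤e (<⇒≱ e<N)
    reach (suc fuel) {e} c N≤ | _ , st | yes e<N with spanned (≤-<-trans z≤n (s<e st)) e<N
    ... | spanning {b = b} a<e e<b b≤N chord =
      reach fuel (extend c a<e e<b b≤N chord)
        (≤-trans N≤ (≤-trans (≤-reflexive (≡.sym (+-suc fuel e))) (+-monoʳ-≤ fuel e<b)))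

    short-tour : 0 < N → Σ (Walk G (v N) (v N)) λ T → Covers T N × 3 * len T ≤ 4 * N + 2
    short-tour 0<N with top (reach N (first (initialStage 0<N)) (m≤m+n N 1))
    ... | _ , st = tour st , tour-covers st , tour-bound st

  module Hamiltonian (unique : Unique (vertices P)) (complete : ∀ z → z ∈ vertices P) where

    pos : Fin n → ℕ
    pos z = proj₁ (∈⇒vertexAt P (complete z))

    pos≤N : ∀ z → pos z ≤ N
    pos≤N z = proj₁ (proj₂ (∈⇒vertexAt P (complete z)))

    v-pos : ∀ z → v (pos z) ≡ z
    v-pos z = proj₂ (proj₂ (∈⇒vertexAt P (complete z)))

    pos-v : ∀ {i} → i ≤ N → pos (v i) ≡ i
    pos-v i≤N = vertexAt-injective P unique (pos≤N _) i≤N (v-pos _)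

    vertex-count : n ≡ suc N
    vertex-count = ≤-antisym (injective⇒≤ pos-injective) (injective⇒≤ v-injective)
      where
      pos-injective : ∀ {z z′} → fromℕ< (s≤s (pos≤N z)) ≡ fromℕ< (s≤s (pos≤N z′)) → z ≡ z′
      pos-injective {z} {z′} eq =
        ≡.trans (≡.sym (v-pos z)) (≡.trans (cong v (fromℕ<-injective _ _ _ _ eq)) (v-pos z′))
      v-injective : ∀ {k l : Fin (suc N)} → v (toℕ k) ≡ v (toℕ l) → k ≡ l
      v-injective {k} {l} eq =
        toℕ-injective (vertexAt-injective P unique (s≤s⁻¹ (toℕ<n k)) (s≤s⁻¹ (toℕ<n l)) eq)

    crossing : ∀ i {c d} (w : Walk G c d) → All (_≢ v i) (vertices w) → pos c < i → i < pos d →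
               SpanningChord i
    crossing i [ _ ] _ c<i i<c = contradiction c<i (<-asym i<c)
    crossing i (_∷⟨_⟩_ c {c′} adj w) avoid c<i i<d with <-cmp (pos c′) i
    ... | tri< c′<i _ _ = crossing i w (All.tail avoid) c′<i i<d
    ... | tri≈ _ c′≡i _ =
      contradiction (≡.trans (≡.sym (v-pos c′)) (cong v c′≡i)) (All.lookup (All.tail avoid) (source∈ w))
    ... | tri> _ _ i<c′ =
      spanning c<i i<c′ (pos≤N c′) (subst₂ (Adj G) (≡.sym (v-pos c)) (≡.sym (v-pos c′)) adj)

    spanned-by-chords : ((w : Fin n) → ConnectedWithout G w) →
                        ∀ {i} → 0 < i → i < N → SpanningChord i
    spanned-by-chords no-cut {i} 0<i i<N with no-cut (v i) (v 0) (v N) v0≢vi vN≢vi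
      where
      v0≢vi : v 0 ≢ v i
      v0≢vi eq = <⇒≢ 0<i (vertexAt-injective P unique z≤n (<⇒≤ i<N) eq)
      vN≢vi : v N ≢ v i
      vN≢vi eq = <⇒≢ i<N (vertexAt-injective P unique (<⇒≤ i<N) ≤-refl (≡.sym eq))
    ... | w , avoid =
      crossing i w avoid (subst (_< i) (≡.sym (pos-v z≤n)) 0<i)
                         (subst (i <_) (≡.sym (pos-v ≤-refl)) i<N)

theorem2 : (n : ℕ) (G : Graph n) → TwoVertexConnected G → HamiltonianPath G →
    Σ (TSPTour G) λ T → 3 * tourLength T ≤ 4 * n
theorem2 n G (3≤n , _ , no-cut) (_ , _ , P , unique , complete) = (v N , T , visits-all) , bound
  where
  open Positions P
  open Hamiltonian unique complete
  0<N : 0 < N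
  0<N = ≤-trans (s≤s z≤n) (s≤s⁻¹ (≤-trans 3≤n (≤-reflexive vertex-count)))
  result : Σ (Walk G (v N) (v N)) λ T → Covers T N × 3 * len T ≤ 4 * N + 2
  result = short-tour (spanned-by-chords no-cut) 0<N
  T : Walk G (v N) (v N)
  T = proj₁ result
  visits-all : ∀ z → z ∈ vertices T
  visits-all z = subst (_∈ vertices T) (v-pos z) (proj₁ (proj₂ result) (pos≤N z))
  bound : 3 * len T ≤ 4 * n
  bound = begin
    3 * len T     ≤⟨ proj₂ (proj₂ result) ⟩
    4 * N + 2     ≤⟨ +-monoʳ-≤ (4 * N) (s≤s (s≤s z≤n)) ⟩
    4 * N + 4     ≡⟨ +-comm (4 * N) 4 ⟩
    4 + 4 * N     ≡⟨ *-suc 4 N ⟨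
    4 * suc N     ≡⟨ cong (4 *_) vertex-count ⟨
    4 * n         ∎
    where open ≤-Reasoning
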